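{- For each $n\ge 1$, let $H$ be the $n$-vertex graph consisting of a copy of the complete graph $K_{n-1}$ together with one isolated vertex. Then $H$ is isomorphic to $C(\pi)$ for some $\pi\in\mathcal{S}_n(123)$, and also isomorphic to $C(\sigma)$ for some $\sigma\in\mathcal{S}_n(132)$.
   Context: For $\pi=\pi_1\cdots\pi_n\in\mathcal{S}_n$, $C(\pi)$ is the simple graph on vertex set $\{1,\dots,n\}$ (vertex $i$ corresponding to the point $(i,\pi_i)$) in which distinct $i,j$ are adjacent iff there exists $k$ with $k<i$, $k<j$, $\pi_k<\pi_i$ and $\pi_k<\pi_j$ (i.e., it is the competition graph of the digraph with an arc from $j$ to $i$ whenever $i<j$ and $\pi_i<\pi_j$). $\mathcal{S}_n(\tau)$ denotes the set of permutations in $\mathcal{S}_n$ avoiding the pattern $\tau$, i.e., having no subsequence order-isomorphic to $\tau$. -}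

module Defs where

open import Data.Nat using (ℕ; suc)
open import Data.Fin using (Fin; zero; _<_)
open import Data.Fin.Permutation using (Permutation′; _⟨$⟩ʳ_)
open import Data.Product using (Σ; ∃; _×_; _,_)
open import Relation.Nullary using (¬_)
open import Relation.Binary.PropositionalEquality using (_≡_; _≢_)
open import Function.Bundles using (_⇔_)
open import Level using (0ℓ)

-- A permutation π ∈ S_n is a bijection of Fin n (positions 0..n-1 ↦ values 0..n-1);
-- π_i is written  π ⟨$⟩ʳ i.

Contains123 : {n : ℕ} → Permutation′ n → Set
Contains123 {n} π = Σ (Fin n) λ i → Σ (Fin n) λ j → Σ (Fin n) λ k →
  (i < j) × (j < k) × ((π ⟨$⟩ʳ i) < (π ⟨$⟩ʳ j)) × ((π ⟨$⟩ʳ j) < (π ⟨$⟩ʳ k))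

Contains132 : {n : ℕ} → Permutation′ n → Set
Contains132 {n} π = Σ (Fin n) λ i → Σ (Fin n) λ j → Σ (Fin n) λ k →
  (i < j) × (j < k) × ((π ⟨$⟩ʳ i) < (π ⟨$⟩ʳ k)) × ((π ⟨$⟩ʳ k) < (π ⟨$⟩ʳ j))

Avoids123 : {n : ℕ} → Permutation′ n → Set
Avoids123 π = ¬ Contains123 π

Avoids132 : {n : ℕ} → Permutation′ n → Set
Avoids132 π = ¬ Contains132 π

-- A simple graph on vertex set Fin n, given by its adjacency relation
-- (assumed irreflexive and symmetric where relevant).
Graph : ℕ → Set₁
Graph n = Fin n → Fin n → Set

C : {n : ℕ} → Permutation′ n → Graph n
C {n} π i j = (i ≢ j) × (Σ (Fin n) λ k →
  (k < i) × (k < j) × ((π ⟨$⟩ʳ k) < (π ⟨$⟩ʳ i)) × ((π ⟨$⟩ʳ k) < (π ⟨$⟩ʳ j)))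

-- K_{n-1} plus one isolated vertex, on vertex set Fin (suc m) (n = suc m ≥ 1):
-- vertex zero is isolated, the other m vertices are pairwise adjacent.
KPlusIsolated : (m : ℕ) → Graph (suc m)
KPlusIsolated m x y = (x ≢ y) × (x ≢ zero) × (y ≢ zero)

_≅_ : {n : ℕ} → Graph n → Graph n → Set
_≅_ {n} G H = Σ (Permutation′ n) λ f →
  ∀ x y → G x y ⇔ H (f ⟨$⟩ʳ x) (f ⟨$⟩ʳ y)

-- In C(π) the first position 0 is always isolated, since no k precedes
-- it. If moreover π fixes 0, i.e. π_0 = 0 is the smallest value, then k = 0
-- witnesses an edge between any two distinct later positions. Hence every
-- permutation fixing 0 has C(π) equal to K_{n-1} plus an isolated vertex, and
-- the identity map is the required isomorphism.
--
-- It remains to find 0-fixing permutations avoiding each pattern: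
--   * 0 followed by a decreasing sequence (lift₀ reverse) avoids 123, since a
--     123 occurrence would need an increasing pair after the first position;
--   * the identity is increasing, and an increasing permutation avoids 132.
module Submission where

open import Defs
open import Data.Nat using (ℕ; suc; z≤n; s≤s)
import Data.Nat.Properties as ℕ
open import Data.Fin using (Fin; zero; suc; _<_)
open import Data.Fin.Properties using (opposite-prop; toℕ<n)
open import Data.Fin.Permutation
  using (Permutation′; _⟨$⟩ʳ_; _⟨$⟩ˡ_; inverseˡ; id; lift₀; reverse)
open import Data.Product using (Σ; _×_; _,_)
open import Data.Empty using (⊥-elim)
open import Relation.Nullary using (¬_)
open import Relation.Binary.PropositionalEquality
  using (_≡_; _≢_; refl; sym; cong; subst; module ≡-Reasoning)
open import Function.Bundles using (mk⇔)

Increasing : {n : ℕ} → Permutation′ n → Set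
Increasing {n} π = {i j : Fin n} → i < j → π ⟨$⟩ʳ i < π ⟨$⟩ʳ j

Decreasing : {n : ℕ} → Permutation′ n → Set
Decreasing {n} π = {i j : Fin n} → i < j → π ⟨$⟩ʳ j < π ⟨$⟩ʳ i

id-increasing : {n : ℕ} → Increasing (id {n})
id-increasing i<j = i<j

-- reverse sends i to n-1-i, which is strictly decreasing in i.
reverse-decreasing : {n : ℕ} → Decreasing (reverse {n})
reverse-decreasing {n} {i} {j} i<j
  rewrite opposite-prop i | opposite-prop j = ℕ.∸-monoʳ-< (s≤s i<j) (toℕ<n j)

-- In a 132 occurrence the last two entries form a descent.
increasing⇒avoids132 : {n : ℕ} (π : Permutation′ n) → Increasing π → Avoids132 π
increasing⇒avoids132 π inc (_ , _ , _ , _ , j<k , _ , πk<πj) =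
  ℕ.<-asym (inc j<k) πk<πj

-- Position 0 of lift₀ ρ holds the minimum, so the "23" of a 123 occurrence
-- lies in ρ; a decreasing ρ has no ascent.
lift₀-decreasing⇒avoids123 : {n : ℕ} (ρ : Permutation′ n) →
  Decreasing ρ → Avoids123 (lift₀ ρ)
lift₀-decreasing⇒avoids123 ρ dec (_ , zero , _ , () , _)
lift₀-decreasing⇒avoids123 ρ dec (_ , suc j , zero , _ , () , _)
lift₀-decreasing⇒avoids123 ρ dec (_ , suc j , suc k , _ , s≤s j<k , _ , s≤s ρj<ρk) =
  ℕ.<-asym ρj<ρk (dec j<k)

nonzero⇒positive : {n : ℕ} {x : Fin (suc n)} → x ≢ zero → zero {n} < x
nonzero⇒positive {x = zero}  x≢0 = ⊥-elim (x≢0 refl)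
nonzero⇒positive {x = suc _} _   = s≤s z≤n

-- A permutation fixing 0 has its minimum at position 0: every other position
-- carries a larger value, because π is injective.
fixes-zero⇒minimum : {n : ℕ} (π : Permutation′ (suc n)) →
  π ⟨$⟩ʳ zero ≡ zero → {x : Fin (suc n)} → x ≢ zero → π ⟨$⟩ʳ zero < π ⟨$⟩ʳ x
fixes-zero⇒minimum π π0≡0 {x} x≢0 =
  subst (_< π ⟨$⟩ʳ x) (sym π0≡0) (nonzero⇒positive (λ πx≡0 → x≢0 (x≡0 πx≡0)))
  where
  open ≡-Reasoning
  x≡0 : π ⟨$⟩ʳ x ≡ zero → x ≡ zero
  x≡0 πx≡0 = begin
    x                         ≡⟨ sym (inverseˡ π) ⟩
    π ⟨$⟩ˡ (π ⟨$⟩ʳ x)         ≡⟨ cong (π ⟨$⟩ˡ_) πx≡0 ⟩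
    π ⟨$⟩ˡ zero               ≡⟨ cong (π ⟨$⟩ˡ_) (sym π0≡0) ⟩
    π ⟨$⟩ˡ (π ⟨$⟩ʳ zero)      ≡⟨ inverseˡ π ⟩
    zero                      ∎

-- No position precedes 0, so 0 is isolated in C(π) for every π.
zero-isolated : {n : ℕ} (π : Permutation′ (suc n)) (y : Fin (suc n)) →
  ¬ C π zero y
zero-isolated π y (_ , _ , () , _)

C-of-zero-fixing : (m : ℕ) (π : Permutation′ (suc m)) →
  π ⟨$⟩ʳ zero ≡ zero → KPlusIsolated m ≅ C π
C-of-zero-fixing m π π0≡0 = id , λ x y → mk⇔ (complete x y) (sound x y)
  where
  complete : ∀ x y → KPlusIsolated m x y → C π x y
  complete x y (x≢y , x≢0 , y≢0) =
    x≢y , zero , nonzero⇒positive x≢0 , nonzero⇒positive y≢0 ,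
    fixes-zero⇒minimum π π0≡0 x≢0 , fixes-zero⇒minimum π π0≡0 y≢0

  sound : ∀ x y → C π x y → KPlusIsolated m x y
  sound zero y c = ⊥-elim (zero-isolated π y c)
  sound (suc x) zero (_ , _ , _ , () , _)
  sound (suc x) (suc y) (x≢y , _) = x≢y , (λ ()) , (λ ())

mainTheorem3 : (m : ℕ) →
    (Σ (Permutation′ (suc m)) λ π → Avoids123 π × (KPlusIsolated m ≅ C π)) ×
    (Σ (Permutation′ (suc m)) λ σ → Avoids132 σ × (KPlusIsolated m ≅ C σ))
mainTheorem3 m =
  ( lift₀ reverse
  , lift₀-decreasing⇒avoids123 reverse reverse-decreasing
  , C-of-zero-fixing m (lift₀ reverse) refl )
  ,
  ( id
  , increasing⇒avoids132 id id-increasing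
  , C-of-zero-fixing m id refl )
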